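{- Consider the Round-Robin protocol with $n$ agents over a finite item set $M$, as described in the context. Let $i$ be an agent with a normalized, nonnegative, monotone submodular objective $f_i$ and a cardinality constraint $\mathcal{I}_i=\{S\subseteq M:|S|\le k\}$, who follows the greedy policy, ending with set $S_i$. Let $j\neq i$ be any other agent (following an arbitrary policy), let $S_j$ be the set of items selected by agent $j$, and let $g$ be the first item selected by $j$. Define $S'_j=S_j$ if $i<j$ and $S'_j=S_j\setminus\{g\}$ otherwise. Then $f_i(S_i)\ge 0.5\max_{S\in\mathcal{I}_i|S'_j} f_i(S)$.
   Context: For $f:2^M\to\mathbb{R}$ write $f(x\,|\,S)=f(S\cup\{x\})-f(S)$; submodular means $f(x\,|\,S)\ge f(x\,|\,T)$ for $S\subseteq T$, $x\notin T$. For $A\subseteq M$, $\mathcal{I}|A=\{X\cap A: X\in\mathcal{I}\}$. Round-Robin protocol: $|M|=m$; initially the available set is $Q=M$; for rounds $r=1,\dots,\lceil m/n\rceil$ and within each round for agents $1,\dots,n$ in order, the current agent (by an arbitrary policy possibly using full information) either selects one item of $Q$, which is removed from $Q$, or selects nothing. Greedy policy of agent $i$: maintain $S_i$ (initially $\emptyset$); at each turn let $A=\{x\in Q: S_i\cup\{x\}\in\mathcal{I}_i\}$; if $A\neq\emptyset$ select some $j\in\arg\max_{x\in A}f_i(x\,|\,S_i)$ and add it to $S_i$, otherwise select nothing. -}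

module Defs where

open import Level using (Level; suc; _⊔_)
open import Data.Nat as ℕ using (ℕ; zero; NonZero; _∸_)
open import Data.Nat.DivMod using (_/_; _%_)
open import Data.Fin using (Fin; toℕ)
open import Data.Fin.Subset using (Subset; ⊥; _∪_; _∩_; ⁅_⁆; ∁; _∈_; _∉_; _⊆_; ∣_∣)
open import Data.Fin.Subset using () renaming (_-_ to _remove_)
open import Data.Maybe using (Maybe; just; nothing)
open import Data.Product using (Σ; ∃; _×_; _,_)
open import Data.Sum using (_⊎_)
open import Relation.Nullary using (¬_; yes; no)
open import Relation.Binary.PropositionalEquality using (_≡_)
open import Data.Nat using (_≟_)
open import Algebra.Bundles using (CommutativeRing)

-- Value domain: a totally ordered commutative ring (ℝ is an instance).

record OrderedCommRing (c ℓ₁ ℓ₂ : Level) : Set (suc (c ⊔ ℓ₁ ⊔ ℓ₂)) where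
  field
    commutativeRing : CommutativeRing c ℓ₁
  open CommutativeRing commutativeRing public
  field
    _≤_        : Carrier → Carrier → Set ℓ₂
    ≤-refl     : ∀ {x y} → x ≈ y → x ≤ y
    ≤-trans    : ∀ {x y z} → x ≤ y → y ≤ z → x ≤ z
    ≤-antisym  : ∀ {x y} → x ≤ y → y ≤ x → x ≈ y
    ≤-total    : ∀ x y → (x ≤ y) ⊎ (y ≤ x)
    ≤-resp-≈   : ∀ {x x′ y y′} → x ≈ x′ → y ≈ y′ → x ≤ y → x′ ≤ y′
    +-mono-≤   : ∀ {x y} z → x ≤ y → (x + z) ≤ (y + z)
    *-nonneg   : ∀ {x y} → 0# ≤ x → 0# ≤ y → 0# ≤ (x * y)

module SetFunctions {c ℓ₁ ℓ₂} (R : OrderedCommRing c ℓ₁ ℓ₂) where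
  open OrderedCommRing R

  marg : ∀ {m} → (Subset m → Carrier) → Fin m → Subset m → Carrier
  marg f x S = f (S ∪ ⁅ x ⁆) - f S

  Normalized : ∀ {m} → (Subset m → Carrier) → Set ℓ₁
  Normalized f = f ⊥ ≈ 0#

  Nonnegative : ∀ {m} → (Subset m → Carrier) → Set ℓ₂
  Nonnegative f = ∀ S → 0# ≤ f S

  Monotone : ∀ {m} → (Subset m → Carrier) → Set ℓ₂
  Monotone f = ∀ {S T} → S ⊆ T → f S ≤ f T

  Submodular : ∀ {m} → (Subset m → Carrier) → Set ℓ₂
  Submodular f = ∀ {S T} x → S ⊆ T → x ∉ T → marg f x T ≤ marg f x S

SetSystem : ℕ → Set₁
SetSystem m = Subset m → Set

cardinality : ∀ {m} → ℕ → SetSystem m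
cardinality k S = ∣ S ∣ ℕ.≤ k

restrict : ∀ {m} → SetSystem m → Subset m → SetSystem m
restrict I A S = ∃ λ X → I X × S ≡ X ∩ A

-- Agents are Fin n (agent a is the (toℕ a + 1)-th
-- in the order).  Turns are numbered 0,1,2,…; turn t belongs to agent
-- t % n.  A play is a
-- function giving, for each turn, the selection (an item or nothing).

Play : ℕ → Set
Play m = ℕ → Maybe (Fin m)

rounds : (m n : ℕ) → .{{NonZero n}} → ℕ
rounds m n = (m ℕ.+ (n ∸ 1)) / n      -- = ⌈ m / n ⌉

turns : (m n : ℕ) → .{{NonZero n}} → ℕ
turns m n = rounds m n ℕ.* n

owner : ∀ {n} .{{_ : NonZero n}} → ℕ → Fin n → Set
owner {n} t a = t % n ≡ toℕ a

addPick : ∀ {m} → Maybe (Fin m) → Subset m → Subset m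
addPick (just x) S = S ∪ ⁅ x ⁆
addPick nothing  S = S

taken : ∀ {m} → Play m → ℕ → Subset m
taken p zero      = ⊥
taken p (ℕ.suc t) = addPick (p t) (taken p t)

available : ∀ {m} → Play m → ℕ → Subset m
available p t = ∁ (taken p t)

selectedBy : ∀ {m n} .{{_ : NonZero n}} → Play m → Fin n → ℕ → Subset m
selectedBy p a zero = ⊥
selectedBy {n = n} p a (ℕ.suc t) with t % n ≟ toℕ a
... | yes _ = addPick (p t) (selectedBy p a t)
... | no  _ = selectedBy p a t

firstPickBy : ∀ {m n} .{{_ : NonZero n}} → Play m → Fin n → ℕ → Maybe (Fin m)
firstPickBy p a zero = nothing
firstPickBy {n = n} p a (ℕ.suc t) with firstPickBy p a t
... | just x = just x
... | nothing with t % n ≟ toℕ a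
...   | yes _ = p t
...   | no  _ = nothing

removePick : ∀ {m} → Subset m → Maybe (Fin m) → Subset m
removePick S (just g) = S remove g
removePick S nothing  = S

LegalPlay : ∀ {m n} .{{_ : NonZero n}} → Play m → Set
LegalPlay {m} {n} p = ∀ t x → t ℕ.< turns m n → p t ≡ just x → x ∈ available p t

module Greedy {c ℓ₁ ℓ₂} (R : OrderedCommRing c ℓ₁ ℓ₂) where
  open OrderedCommRing R
  open SetFunctions R

  Candidate : ∀ {m n} .{{_ : NonZero n}} → Play m → Fin n → SetSystem m → ℕ → Fin m → Set
  Candidate p a I t x = x ∈ available p t × I (selectedBy p a t ∪ ⁅ x ⁆)

  FollowsGreedy : ∀ {m n} .{{_ : NonZero n}} → Play m → Fin n →
                  (Subset m → Carrier) → SetSystem m → Set ℓ₂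
  FollowsGreedy {m} {n} p a f I =
    ∀ t → t ℕ.< turns m n → owner t a →
      ((∃ λ x → Candidate p a I t x) →
         ∃ λ x → p t ≡ just x × Candidate p a I t x ×
           (∀ y → Candidate p a I t y →
              marg f y (selectedBy p a t) ≤ marg f x (selectedBy p a t)))
      × ((¬ ∃ λ x → Candidate p a I t x) → p t ≡ nothing)

-- Write Aₜ for agent i's bundle before turn t, Yₜ for the part of S that j has taken by then,
-- and B = Sᵢ.  Counting turns in the round-robin order, whenever j takes an item of S agent i
-- already holds k items or has made more than |Yₜ| picks: if i moves before j in each round this
-- is its head start, otherwise j's first pick is not in S.  Each item of S can therefore be charged
-- to a distinct earlier greedy pick, chosen while that item was still feasible, so by the greedy
-- rule and submodularity its marginal value over B is at most that pick's marginal value.  This is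
-- maintained as the potential inequality f(B ∪ Yₜ) + e·w ≤ f(B) + f(Aₜ), with e = |Aₜ| − |Yₜ|
-- uncharged picks, each worth at least the marginal value w of the latest one; at the end
-- f(S) ≤ f(B ∪ S) ≤ 2 f(B).

module Submission where

open import Defs
open import Level using (_⊔_)
open import Data.Nat as ℕ using (ℕ; NonZero; _<_)
import Data.Nat.Properties as ℕₚ
open import Data.Fin as Fin using (Fin; toℕ)
open import Data.Fin.Subset using (Subset; ⊥; _∪_; _∩_; ⁅_⁆; _∈_; _∉_; _⊆_; ∣_∣; _─_)
open import Data.Fin.Subset.Properties using (⊆-refl; p∩q⊆q; ∣p∩q∣≤∣p∣; x∈⁅x⁆)
open import Data.Maybe using (Maybe; just; nothing)
open import Data.Product using (_×_; _,_)
open import Data.Sum using (_⊎_; inj₁; inj₂)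
open import Relation.Nullary using (¬_; yes; no; contradiction)
open import Relation.Binary.PropositionalEquality
  using (_≡_; _≢_; refl; sym; trans; cong; cong₂; subst; ≢-sym; module ≡-Reasoning)

module Subsets where

  open import Data.Nat using (suc; _≤_; s≤s; _≤′_; ≤′-refl; ≤′-step)
  open import Data.Fin.Subset using (inside; outside)
  open import Data.Fin.Subset.Properties
    using (⊥⊆; ⊆-antisym; p⊆p∪q; q⊆p∪q; x∈p∪q⁻; x∈p∩q⁺; x∈p∩q⁻; x∈⁅y⁆⇒x≡y; p⊂q⇒∣p∣<∣q∣;
           ∪-identityʳ; ∩-distribˡ-∪; p─q⊆p)
  open import Data.Vec.Base using (_∷_; here; there)

  ∣p∪⁅x⁆∣≤1+∣p∣ : ∀ {m} (p : Subset m) x → ∣ p ∪ ⁅ x ⁆ ∣ ≤ suc ∣ p ∣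
  ∣p∪⁅x⁆∣≤1+∣p∣ (inside  ∷ p) Fin.zero rewrite ∪-identityʳ p = s≤s (ℕₚ.n≤1+n _)
  ∣p∪⁅x⁆∣≤1+∣p∣ (outside ∷ p) Fin.zero rewrite ∪-identityʳ p = ℕₚ.≤-refl
  ∣p∪⁅x⁆∣≤1+∣p∣ (inside  ∷ p) (Fin.suc x) = s≤s (∣p∪⁅x⁆∣≤1+∣p∣ p x)
  ∣p∪⁅x⁆∣≤1+∣p∣ (outside ∷ p) (Fin.suc x) = ∣p∪⁅x⁆∣≤1+∣p∣ p x

  x∈p─q⇒x∉q : ∀ {m} {p q : Subset m} {x} → x ∈ p ─ q → x ∉ q
  x∈p─q⇒x∉q {p = _ ∷ _} {outside ∷ _} here          ()
  x∈p─q⇒x∉q {p = _ ∷ _} {_ ∷ _}       (there x∈p─q) (there x∈q) = x∈p─q⇒x∉q x∈p─q x∈q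

  module _ {m : ℕ} where

    x∈p∪⁅x⁆ : ∀ (p : Subset m) x → x ∈ p ∪ ⁅ x ⁆
    x∈p∪⁅x⁆ p x = q⊆p∪q p ⁅ x ⁆ (x∈⁅x⁆ x)

    x∉p⇒∣p∪⁅x⁆∣≡1+∣p∣ : ∀ {p : Subset m} {x} → x ∉ p → ∣ p ∪ ⁅ x ⁆ ∣ ≡ suc ∣ p ∣
    x∉p⇒∣p∪⁅x⁆∣≡1+∣p∣ {p} {x} x∉p =
      ℕₚ.≤-antisym (∣p∪⁅x⁆∣≤1+∣p∣ p x) (p⊂q⇒∣p∣<∣q∣ (p⊆p∪q ⁅ x ⁆ , x , x∈p∪⁅x⁆ p x , x∉p))

    p⊆q⇒p∪r⊆q∪r : ∀ {p q : Subset m} r → p ⊆ q → p ∪ r ⊆ q ∪ r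
    p⊆q⇒p∪r⊆q∪r {p} r p⊆q z∈p∪r with x∈p∪q⁻ p r z∈p∪r
    ... | inj₁ z∈p = p⊆p∪q r (p⊆q z∈p)
    ... | inj₂ z∈r = q⊆p∪q _ r z∈r

    x∈p⇒p∩⁅x⁆≡⁅x⁆ : ∀ {p : Subset m} {x} → x ∈ p → p ∩ ⁅ x ⁆ ≡ ⁅ x ⁆
    x∈p⇒p∩⁅x⁆≡⁅x⁆ {p} {x} x∈p = ⊆-antisym (p∩q⊆q p ⁅ x ⁆) ⁅x⁆⊆p∩⁅x⁆
      where
      ⁅x⁆⊆p∩⁅x⁆ : ⁅ x ⁆ ⊆ p ∩ ⁅ x ⁆
      ⁅x⁆⊆p∩⁅x⁆ z∈⁅x⁆ with x∈⁅y⁆⇒x≡y x z∈⁅x⁆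
      ... | refl = x∈p∩q⁺ (x∈p , z∈⁅x⁆)

    x∉p⇒p∩⁅x⁆≡⊥ : ∀ {p : Subset m} {x} → x ∉ p → p ∩ ⁅ x ⁆ ≡ ⊥
    x∉p⇒p∩⁅x⁆≡⊥ {p} {x} x∉p = ⊆-antisym p∩⁅x⁆⊆⊥ ⊥⊆
      where
      p∩⁅x⁆⊆⊥ : p ∩ ⁅ x ⁆ ⊆ ⊥
      p∩⁅x⁆⊆⊥ z∈ with x∈p∩q⁻ p ⁅ x ⁆ z∈
      ... | z∈p , z∈⁅x⁆ with x∈⁅y⁆⇒x≡y x z∈⁅x⁆
      ...   | refl = contradiction z∈p x∉p

    x∈p⇒p∩[q∪⁅x⁆]≡p∩q∪⁅x⁆ : ∀ {p : Subset m} q {x} → x ∈ p → p ∩ (q ∪ ⁅ x ⁆) ≡ p ∩ q ∪ ⁅ x ⁆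
    x∈p⇒p∩[q∪⁅x⁆]≡p∩q∪⁅x⁆ {p} q {x} x∈p =
      trans (∩-distribˡ-∪ p q ⁅ x ⁆) (cong (p ∩ q ∪_) (x∈p⇒p∩⁅x⁆≡⁅x⁆ x∈p))

    x∉p⇒p∩[q∪⁅x⁆]≡p∩q : ∀ {p : Subset m} q {x} → x ∉ p → p ∩ (q ∪ ⁅ x ⁆) ≡ p ∩ q
    x∉p⇒p∩[q∪⁅x⁆]≡p∩q {p} q {x} x∉p =
      trans (∩-distribˡ-∪ p q ⁅ x ⁆) (trans (cong (p ∩ q ∪_) (x∉p⇒p∩⁅x⁆≡⊥ x∉p)) (∪-identityʳ (p ∩ q)))

    ⊆-stepwise : (P : ℕ → Subset m) → (∀ t → P t ⊆ P (suc t)) → ∀ {t t′} → t ≤′ t′ → P t ⊆ P t′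
    ⊆-stepwise P step ≤′-refl         = ⊆-refl
    ⊆-stepwise P step (≤′-step t≤′t′) = λ z∈ → step _ (⊆-stepwise P step t≤′t′ z∈)

    p⊆addPick : ∀ mx (p : Subset m) → p ⊆ addPick mx p
    p⊆addPick (just x) p = p⊆p∪q ⁅ x ⁆
    p⊆addPick nothing  p = ⊆-refl

    addPick-mono : ∀ mx {p q : Subset m} → p ⊆ q → addPick mx p ⊆ addPick mx q
    addPick-mono (just x) = p⊆q⇒p∪r⊆q∪r ⁅ x ⁆
    addPick-mono nothing p⊆q = p⊆q

    ∈-addPick⁻ : ∀ mx (p : Subset m) {x} → x ∈ addPick mx p → x ∈ p ⊎ mx ≡ just x
    ∈-addPick⁻ nothing  p x∈ = inj₁ x∈
    ∈-addPick⁻ (just y) p x∈ with x∈p∪q⁻ p ⁅ y ⁆ x∈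
    ... | inj₁ x∈p = inj₁ x∈p
    ... | inj₂ x∈y = inj₂ (cong just (sym (x∈⁅y⁆⇒x≡y y x∈y)))

    ∣addPick∣≤1+∣p∣ : ∀ mx (p : Subset m) → ∣ addPick mx p ∣ ≤ suc ∣ p ∣
    ∣addPick∣≤1+∣p∣ (just x) p = ∣p∪⁅x⁆∣≤1+∣p∣ p x
    ∣addPick∣≤1+∣p∣ nothing  p = ℕₚ.n≤1+n ∣ p ∣

    removePick-⊆ : ∀ (p : Subset m) mg → removePick p mg ⊆ p
    removePick-⊆ p (just g) = p─q⊆p p ⁅ g ⁆
    removePick-⊆ p nothing  = ⊆-refl

open Subsets

module OrderedCommRingProperties {c ℓ₁ ℓ₂} (R : OrderedCommRing c ℓ₁ ℓ₂) where

  open import Data.Nat using (zero; suc)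
  open import Relation.Binary.Bundles using (Poset)
  import Relation.Binary.Reasoning.PartialOrder
  open OrderedCommRing R public hiding (zero)
    renaming (_≤_ to infix 4 _≤_; refl to ≈-refl; sym to ≈-sym; trans to ≈-trans)
  open import Algebra.Definitions.RawMonoid +-rawMonoid public renaming (_×_ to _×ₙ_)

  ≤-poset : Poset c ℓ₁ ℓ₂
  ≤-poset = record
    { isPartialOrder = record
      { isPreorder = record { isEquivalence = isEquivalence ; reflexive = ≤-refl ; trans = ≤-trans }
      ; antisym    = ≤-antisym
      }
    }

  module ≤-Reasoning = Relation.Binary.Reasoning.PartialOrder ≤-poset

  +-monoʳ-≤ : ∀ {x y} z → x ≤ y → z + x ≤ z + y
  +-monoʳ-≤ {x} {y} z x≤y = ≤-resp-≈ (+-comm x z) (+-comm y z) (+-mono-≤ z x≤y)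

  +-mono₂-≤ : ∀ {x y u v} → x ≤ y → u ≤ v → x + u ≤ y + v
  +-mono₂-≤ {y = y} {u} x≤y u≤v = ≤-trans (+-mono-≤ u x≤y) (+-monoʳ-≤ y u≤v)

  x≤x+y : ∀ {x y} → 0# ≤ y → x ≤ x + y
  x≤x+y {x} 0≤y = ≤-resp-≈ (+-identityʳ x) ≈-refl (+-monoʳ-≤ x 0≤y)

  x≤y⇒0≤y-x : ∀ {x y} → x ≤ y → 0# ≤ y - x
  x≤y⇒0≤y-x {x} x≤y = ≤-resp-≈ (-‿inverseʳ x) ≈-refl (+-mono-≤ (- x) x≤y)

  x+[y-x]≈y : ∀ x y → x + (y - x) ≈ y
  x+[y-x]≈y x y = begin
    x + (y - x)    ≈⟨ +-comm x (y - x) ⟩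
    y - x + x      ≈⟨ +-assoc y (- x) x ⟩
    y + (- x + x)  ≈⟨ +-congˡ (-‿inverseˡ x) ⟩
    y + 0#         ≈⟨ +-identityʳ y ⟩
    y              ∎
    where open import Relation.Binary.Reasoning.Setoid setoid

  ×ₙ-nonneg : ∀ e {w} → 0# ≤ w → 0# ≤ e ×ₙ w
  ×ₙ-nonneg zero    0≤w = ≤-refl ≈-refl
  ×ₙ-nonneg (suc e) 0≤w = ≤-resp-≈ (+-identityʳ 0#) ≈-refl (+-mono₂-≤ 0≤w (×ₙ-nonneg e 0≤w))

  ×ₙ-monoʳ-≤ : ∀ e {v w} → v ≤ w → e ×ₙ v ≤ e ×ₙ w
  ×ₙ-monoʳ-≤ zero    v≤w = ≤-refl ≈-refl
  ×ₙ-monoʳ-≤ (suc e) v≤w = +-mono₂-≤ v≤w (×ₙ-monoʳ-≤ e v≤w)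

module Schedule where

  open import Data.Nat using (zero; suc; _+_; _≤_; z≤n; _≟_; _<?_; _≤?_)
  open import Data.Nat.DivMod using (_%_; _/_; m≡m%n+[m/n]*n; [m+kn]%n≡m%n; m<n⇒m%n≡m; n%n≡0; m%n<n)
  open import Relation.Nullary.Decidable using (_×-dec_)
  open import Relation.Binary.Definitions using (tri<; tri≈; tri>)

  -- At position r of a round, agent a has already moved in this round and agent b has not.
  window : ℕ → ℕ → ℕ → ℕ
  window a b r with (a <? r) ×-dec (r ≤? b)
  ... | yes _ = 1
  ... | no  _ = 0

  window-1 : ∀ {a b r} → a < r → r ≤ b → window a b r ≡ 1
  window-1 {a} {b} {r} a<r r≤b with (a <? r) ×-dec (r ≤? b)
  ... | yes _ = refl
  ... | no ¬p = contradiction (a<r , r≤b) ¬p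

  window-0 : ∀ {a b r} → ¬ (a < r × r ≤ b) → window a b r ≡ 0
  window-0 {a} {b} {r} ¬p with (a <? r) ×-dec (r ≤? b)
  ... | yes p = contradiction p ¬p
  ... | no  _ = refl

  window-cong : ∀ {a b r r′} → (a < r × r ≤ b → a < r′ × r′ ≤ b) → (a < r′ × r′ ≤ b → a < r × r ≤ b) →
                window a b r ≡ window a b r′
  window-cong {a} {b} {r} {r′} to from with (a <? r) ×-dec (r ≤? b) | (a <? r′) ×-dec (r′ ≤? b)
  ... | yes _ | yes _  = refl
  ... | no  _ | no  _  = refl
  ... | yes p | no ¬q  = contradiction (to p) ¬q
  ... | no ¬p | yes q  = contradiction (from q) ¬p

  window-≤ : ∀ a b {r} → r ≤ a → window a b r ≡ 0
  window-≤ a b r≤a = window-0 λ (a<r , _) → ℕₚ.<⇒≱ a<r r≤a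

  window-> : ∀ a b {r} → b < r → window a b r ≡ 0
  window-> a b b<r = window-0 λ (_ , r≤b) → ℕₚ.<⇒≱ b<r r≤b

  data NextPosition (n : ℕ) : ℕ → ℕ → Set where
    step : ∀ {r} → suc r < n → NextPosition n r (suc r)
    wrap : ∀ {r} → suc r ≡ n → NextPosition n r 0

  suc[t]%n≡suc[t%n]%n : ∀ n .{{_ : NonZero n}} t → suc t % n ≡ suc (t % n) % n
  suc[t]%n≡suc[t%n]%n n t =
    trans (cong (λ s → suc s % n) (m≡m%n+[m/n]*n t n)) ([m+kn]%n≡m%n (suc (t % n)) (t / n) n)

  nextPosition : ∀ n .{{_ : NonZero n}} t → NextPosition n (t % n) (suc t % n)
  nextPosition n t with ℕₚ.m≤n⇒m<n∨m≡n (m%n<n t n)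
  ... | inj₁ r+1<n = subst (NextPosition n (t % n)) (sym (trans (suc[t]%n≡suc[t%n]%n n t) (m<n⇒m%n≡m r+1<n)))
                           (step r+1<n)
  ... | inj₂ r+1≡n = subst (NextPosition n (t % n))
                           (sym (trans (suc[t]%n≡suc[t%n]%n n t) (trans (cong (_% n) r+1≡n) (n%n≡0 n))))
                           (wrap r+1≡n)

  window-stable : ∀ {n a b r r′} → r ≢ a → r ≢ b → b < n → NextPosition n r r′ → window a b r′ ≡ window a b r
  window-stable {a = a} {b} {r} r≢a r≢b b<n (step _) = sym (window-cong to from)
    where
    to : a < r × r ≤ b → a < suc r × suc r ≤ b
    to (a<r , r≤b) = ℕₚ.m<n⇒m<1+n a<r , ℕₚ.≤∧≢⇒< r≤b r≢b
    from : a < suc r × suc r ≤ b → a < r × r ≤ b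
    from (a<1+r , 1+r≤b) = ℕₚ.≤∧≢⇒< (ℕₚ.≤-pred a<1+r) (≢-sym r≢a) , ℕₚ.<⇒≤ 1+r≤b
  window-stable {a = a} {b} {r} r≢a r≢b b<n (wrap 1+r≡n) =
    trans (window-≤ a b z≤n) (sym (window-0 λ (_ , r≤b) → r≢b (ℕₚ.≤-antisym r≤b b≤r)))
    where
    b≤r : b ≤ r
    b≤r = ℕₚ.≤-pred (subst (_ <_) (sym 1+r≡n) b<n)

  window-after-own-turn : ∀ {n a b r′} → NextPosition n a r′ → window b a r′ ≡ 0
  window-after-own-turn {a = a} {b} (step _) = window-> b a (ℕₚ.n<1+n a)
  window-after-own-turn {a = a} {b} (wrap _) = window-≤ b a z≤n

  -- At a's turn, b has either already moved in this round or moves later in it.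
  windows-complement : ∀ {n a b r′} → a ≢ b → b < n → NextPosition n a r′ → window b a a + window a b r′ ≡ 1
  windows-complement {a = a} {b} a≢b b<n next with ℕₚ.<-cmp a b | next
  ... | tri≈ _ a≡b _ | _          = contradiction a≡b a≢b
  ... | tri< a<b _ _ | step _     = cong₂ _+_ (window-≤ b a (ℕₚ.<⇒≤ a<b)) (window-1 (ℕₚ.n<1+n a) a<b)
  ... | tri< a<b _ _ | wrap 1+a≡n = contradiction a<b (ℕₚ.<⇒≱ (subst (b <_) (sym 1+a≡n) b<n))
  ... | tri> _ _ b<a | step _     = cong₂ _+_ (window-1 b<a ℕₚ.≤-refl) (window-> a b (ℕₚ.m<n⇒m<1+n b<a))
  ... | tri> _ _ b<a | wrap _     = cong₂ _+_ (window-1 b<a ℕₚ.≤-refl) (window-≤ a b z≤n)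

  window-own-turn : ∀ {n a b r′ x y} → a ≢ b → b < n → NextPosition n a r′ →
                    x + window a b a ≡ y + window b a a → x + window a b r′ ≡ suc y + window b a r′
  window-own-turn {a = a} {b} {r′} {x} {y} a≢b b<n next eq = begin
    x + window a b r′                   ≡⟨ cong (_+ window a b r′) x≡y+w ⟩
    y + window b a a + window a b r′    ≡⟨ ℕₚ.+-assoc y (window b a a) (window a b r′) ⟩
    y + (window b a a + window a b r′)  ≡⟨ cong (y +_) (windows-complement a≢b b<n next) ⟩
    y + 1                               ≡⟨ ℕₚ.+-comm y 1 ⟩
    suc y                               ≡⟨ ℕₚ.+-identityʳ (suc y) ⟨
    suc y + 0                           ≡⟨ cong (suc y +_) (window-after-own-turn next) ⟨
    suc y + window b a r′               ∎
    where
    open ≡-Reasoning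
    x≡y+w : x ≡ y + window b a a
    x≡y+w = trans (sym (ℕₚ.+-identityʳ x)) (trans (cong (x +_) (sym (window-≤ a b ℕₚ.≤-refl))) eq)

  module _ (n : ℕ) .{{_ : NonZero n}} where

    turnsAt : ℕ → ℕ → ℕ
    turnsAt r zero    = 0
    turnsAt r (suc t) with t % n ≟ r
    ... | yes _ = suc (turnsAt r t)
    ... | no  _ = turnsAt r t

    -- Two agents have had equally many turns, up to the moves already made in the current round.
    turnsAt-balance : ∀ {a b} → a < n → b < n → a ≢ b → ∀ t →
                      turnsAt b t + window a b (t % n) ≡ turnsAt a t + window b a (t % n)
    turnsAt-balance {a} {b} _ _ _ zero rewrite m<n⇒m%n≡m (ℕ.>-nonZero⁻¹ n) =
      trans (window-≤ a b z≤n) (sym (window-≤ b a z≤n))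
    turnsAt-balance {a} {b} a<n b<n a≢b (suc t) with t % n ≟ a | t % n ≟ b
    ... | yes r≡a | yes r≡b = contradiction (trans (sym r≡a) r≡b) a≢b
    ... | yes refl | no _   = window-own-turn a≢b b<n (nextPosition n t) (turnsAt-balance a<n b<n a≢b t)
    ... | no _ | yes refl   =
      sym (window-own-turn (≢-sym a≢b) a<n (nextPosition n t) (sym (turnsAt-balance a<n b<n a≢b t)))
    ... | no r≢a | no r≢b   = begin
      turnsAt b t + window a b (suc t % n)  ≡⟨ cong (turnsAt b t +_) (window-stable r≢a r≢b b<n next) ⟩
      turnsAt b t + window a b (t % n)      ≡⟨ turnsAt-balance a<n b<n a≢b t ⟩
      turnsAt a t + window b a (t % n)      ≡⟨ cong (turnsAt a t +_) (window-stable r≢b r≢a a<n next) ⟨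
      turnsAt a t + window b a (suc t % n)  ∎
      where
      open ≡-Reasoning
      next : NextPosition n (t % n) (suc t % n)
      next = nextPosition n t

    turnsAt-at-own-turn : ∀ {a b} → a < n → b < n → a ≢ b → ∀ t → t % n ≡ b →
                          turnsAt b t + window a b b ≡ turnsAt a t
    turnsAt-at-own-turn {a} {b} a<n b<n a≢b t r≡b = begin
      turnsAt b t + window a b b        ≡⟨ cong (λ r → turnsAt b t + window a b r) r≡b ⟨
      turnsAt b t + window a b (t % n)  ≡⟨ turnsAt-balance a<n b<n a≢b t ⟩
      turnsAt a t + window b a (t % n)  ≡⟨ cong (λ r → turnsAt a t + window b a r) r≡b ⟩
      turnsAt a t + window b a b        ≡⟨ cong (turnsAt a t +_) (window-≤ b a ℕₚ.≤-refl) ⟩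
      turnsAt a t + 0                   ≡⟨ ℕₚ.+-identityʳ (turnsAt a t) ⟩
      turnsAt a t                       ∎
      where open ≡-Reasoning

open Schedule

module Protocol {m n : ℕ} .{{_ : NonZero n}} (p : Play m) where

  open import Data.Nat using (zero; suc; _≤_; s≤s; _≟_)
  open import Data.Nat.DivMod using (_%_)
  open import Data.Fin.Properties using (toℕ-injective)
  open import Data.Fin.Subset.Properties using (x∈∁p⇒x∉p; p⊆q⇒∁p⊇∁q; ∉⊥; ∣⊥∣≡0)

  module _ {a : Fin n} {t : ℕ} where

    selectedBy-own : t % n ≡ toℕ a → selectedBy p a (suc t) ≡ addPick (p t) (selectedBy p a t)
    selectedBy-own own with t % n ≟ toℕ a
    ... | yes _    = refl
    ... | no ¬own  = contradiction own ¬own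

    selectedBy-other : t % n ≢ toℕ a → selectedBy p a (suc t) ≡ selectedBy p a t
    selectedBy-other ¬own with t % n ≟ toℕ a
    ... | yes own = contradiction own ¬own
    ... | no  _   = refl

    selectedBy-pick : ∀ {x} → t % n ≡ toℕ a → p t ≡ just x → selectedBy p a (suc t) ≡ selectedBy p a t ∪ ⁅ x ⁆
    selectedBy-pick own pt = trans (selectedBy-own own) (cong (λ mx → addPick mx (selectedBy p a t)) pt)

    selectedBy-pass : t % n ≡ toℕ a → p t ≡ nothing → selectedBy p a (suc t) ≡ selectedBy p a t
    selectedBy-pass own pt = trans (selectedBy-own own) (cong (λ mx → addPick mx (selectedBy p a t)) pt)

  selectedBy-step : ∀ a t → selectedBy p a t ⊆ selectedBy p a (suc t)
  selectedBy-step a t with t % n ≟ toℕ a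
  ... | yes _ = p⊆addPick (p t) (selectedBy p a t)
  ... | no  _ = ⊆-refl

  selectedBy-mono : ∀ a {t t′} → t ≤ t′ → selectedBy p a t ⊆ selectedBy p a t′
  selectedBy-mono a t≤t′ = ⊆-stepwise (selectedBy p a) (selectedBy-step a) (ℕₚ.≤⇒≤′ t≤t′)

  available-antitone : ∀ {t t′} → t ≤ t′ → available p t′ ⊆ available p t
  available-antitone t≤t′ =
    p⊆q⇒∁p⊇∁q (⊆-stepwise (taken p) (λ t → p⊆addPick (p t) (taken p t)) (ℕₚ.≤⇒≤′ t≤t′))

  available-step : ∀ t → available p (suc t) ⊆ available p t
  available-step t = available-antitone (ℕₚ.n≤1+n t)

  selectedBy⊆taken : ∀ a t → selectedBy p a t ⊆ taken p t
  selectedBy⊆taken a zero    = ⊆-refl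
  selectedBy⊆taken a (suc t) with t % n ≟ toℕ a
  ... | yes _ = addPick-mono (p t) (selectedBy⊆taken a t)
  ... | no  _ = λ x∈ → p⊆addPick (p t) (taken p t) (selectedBy⊆taken a t x∈)

  available⇒∉selectedBy : ∀ a t {x} → x ∈ available p t → x ∉ selectedBy p a t
  available⇒∉selectedBy a t x∈Q x∈S = x∈∁p⇒x∉p x∈Q (selectedBy⊆taken a t x∈S)

  ∣selectedBy∣≤turnsAt : ∀ a t → ∣ selectedBy p a t ∣ ≤ turnsAt n (toℕ a) t
  ∣selectedBy∣≤turnsAt a zero    = ℕₚ.≤-reflexive (∣⊥∣≡0 m)
  ∣selectedBy∣≤turnsAt a (suc t) with t % n ≟ toℕ a
  ... | yes _ = ℕₚ.≤-trans (∣addPick∣≤1+∣p∣ (p t) (selectedBy p a t)) (s≤s (∣selectedBy∣≤turnsAt a t))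
  ... | no  _ = ∣selectedBy∣≤turnsAt a t

  -- Only items still available are picked, so no item is picked twice.
  selectedBy-disjoint : LegalPlay p → ∀ {a b} → a ≢ b → ∀ t → t ≤ turns m n →
                        ∀ {x} → x ∈ selectedBy p a t → x ∉ selectedBy p b t
  selectedBy-disjoint legal a≢b zero    _   x∈a _ = ∉⊥ x∈a
  selectedBy-disjoint legal {a} {b} a≢b (suc t) t<T {x} x∈a x∈b with t % n ≟ toℕ a | t % n ≟ toℕ b
  ... | yes ownᵃ | yes ownᵇ = a≢b (toℕ-injective (trans (sym ownᵃ) ownᵇ))
  ... | yes _ | no _ with ∈-addPick⁻ (p t) (selectedBy p a t) x∈a
  ...   | inj₁ x∈a′ = selectedBy-disjoint legal a≢b t (ℕₚ.<⇒≤ t<T) x∈a′ x∈b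
  ...   | inj₂ pt   = available⇒∉selectedBy b t (legal t x t<T pt) x∈b
  selectedBy-disjoint legal {a} {b} a≢b (suc t) t<T {x} x∈a x∈b | no _ | yes _
    with ∈-addPick⁻ (p t) (selectedBy p b t) x∈b
  ...   | inj₁ x∈b′ = selectedBy-disjoint legal a≢b t (ℕₚ.<⇒≤ t<T) x∈a x∈b′
  ...   | inj₂ pt   = available⇒∉selectedBy a t (legal t x t<T pt) x∈a
  selectedBy-disjoint legal a≢b (suc t) t<T x∈a x∈b | no _ | no _ =
    selectedBy-disjoint legal a≢b t (ℕₚ.<⇒≤ t<T) x∈a x∈b

  firstPickBy-stable : ∀ a {t t′ g} → t ≤ t′ → firstPickBy p a t ≡ just g → firstPickBy p a t′ ≡ just g
  firstPickBy-stable a t≤t′ = go (ℕₚ.≤⇒≤′ t≤t′)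
    where
    go : ∀ {t t′ g} → t ℕ.≤′ t′ → firstPickBy p a t ≡ just g → firstPickBy p a t′ ≡ just g
    go ℕ.≤′-refl         fp≡g = fp≡g
    go (ℕ.≤′-step t≤′t′) fp≡g rewrite go t≤′t′ fp≡g = refl

  firstPickBy-own : ∀ a t → firstPickBy p a t ≡ nothing → t % n ≡ toℕ a → firstPickBy p a (suc t) ≡ p t
  firstPickBy-own a t none own rewrite none with t % n ≟ toℕ a
  ... | yes _   = refl
  ... | no ¬own = contradiction own ¬own

  firstPickBy∈selectedBy : ∀ a t {g} → firstPickBy p a t ≡ just g → g ∈ selectedBy p a t
  firstPickBy∈selectedBy a (suc t) {g} fp≡g with firstPickBy p a t in fp₀
  ... | just _ with fp≡g
  ...   | refl = selectedBy-step a t (firstPickBy∈selectedBy a t fp₀)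
  firstPickBy∈selectedBy a (suc t) {g} fp≡g | nothing with t % n ≟ toℕ a
  ...   | yes _ = picked (p t) fp≡g
    where
    picked : ∀ mx → mx ≡ just g → g ∈ addPick mx (selectedBy p a t)
    picked (just x) refl = x∈p∪⁅x⁆ (selectedBy p a t) x
  ...   | no  _ with fp≡g
  ...     | ()

-- Q is the set of items still available, A the greedy agent's current bundle, B its final bundle
-- and Y the part of S already taken by the opponent.
module ExchangePotential
  {c ℓ₁ ℓ₂} (R : OrderedCommRing c ℓ₁ ℓ₂) {m : ℕ} (k : ℕ) (f : Subset m → OrderedCommRing.Carrier R)
  (f-nonneg : SetFunctions.Nonnegative R f) (f-mono : SetFunctions.Monotone R f)
  (f-submodular : SetFunctions.Submodular R f)
  (B S : Subset m) (S∉B : ∀ {y} → y ∈ S → y ∉ B)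
  where

  open import Data.Nat using (zero; suc; s≤s; z≤n)
  open import Data.Fin.Subset.Properties using (p⊆p∪q; x∈p∪q⁻; p⊆q⇒∣p∣≤∣q∣; ∪-identityʳ; ∪-assoc)
  open OrderedCommRingProperties R
  open SetFunctions R
  open import Algebra.Properties.CommutativeSemigroup +-commutativeSemigroup using (x∙yz≈y∙xz)

  Feasible : Subset m → Subset m → Fin m → Set
  Feasible Q A x = x ∈ Q × ∣ A ∪ ⁅ x ⁆ ∣ ℕ.≤ k

  record GreedyChoice (Q A : Subset m) (x : Fin m) : Set ℓ₂ where
    constructor greedyChoice
    field
      feasible : Feasible Q A x
      maximal  : ∀ z → Feasible Q A z → marg f z A ≤ marg f x A

  record GainBound (Q A : Subset m) (w : Carrier) : Set ℓ₂ where
    constructor gainBound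
    field
      on-remaining  : ∀ {y} → y ∈ S → y ∈ Q → marg f y B ≤ w
      on-candidates : ∀ x → Feasible Q A x → marg f x A ≤ w

  record Potential (Q A Y : Subset m) : Set (c ⊔ ℓ₂) where
    constructor potential
    field
      credit         : ℕ
      gain           : Carrier
      credit-balance : credit ℕ.+ ∣ Y ∣ ≡ ∣ A ∣
      gain-nonneg    : 0# ≤ gain
      bound          : f (B ∪ Y) + credit ×ₙ gain ≤ f B + f A
      gain-bound     : 0 < credit → GainBound Q A gain

  gainBound-shrink : ∀ {Q Q′ A w} → Q′ ⊆ Q → GainBound Q A w → GainBound Q′ A w
  gainBound-shrink Q′⊆Q (gainBound rem cand) =
    gainBound (λ y∈S y∈Q′ → rem y∈S (Q′⊆Q y∈Q′)) (λ x (x∈Q′ , fits) → cand x (Q′⊆Q x∈Q′ , fits))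

  potential-shrink : ∀ {Q Q′ A Y} → Q′ ⊆ Q → Potential Q A Y → Potential Q′ A Y
  potential-shrink Q′⊆Q (potential e w bal w≥0 bnd gb) =
    potential e w bal w≥0 bnd (λ e>0 → gainBound-shrink Q′⊆Q (gb e>0))

  potential-empty : ∀ {Q} → Potential Q ⊥ ⊥
  potential-empty = potential 0 0# refl (≤-refl ≈-refl) bnd (λ ())
    where
    open ≤-Reasoning
    bnd : f (B ∪ ⊥) + 0# ≤ f B + f ⊥
    bnd = begin
      f (B ∪ ⊥) + 0#  ≈⟨ +-identityʳ (f (B ∪ ⊥)) ⟩
      f (B ∪ ⊥)       ≡⟨ cong f (∪-identityʳ B) ⟩
      f B             ≤⟨ x≤x+y (f-nonneg ⊥) ⟩
      f B + f ⊥       ∎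

  potential-final : ∀ {Q Y} → Potential Q B Y → f (B ∪ Y) ≤ f B + f B
  potential-final {Y = Y} (potential e w _ w≥0 bnd _) = begin
    f (B ∪ Y)             ≤⟨ x≤x+y (×ₙ-nonneg e w≥0) ⟩
    f (B ∪ Y) + e ×ₙ w    ≤⟨ bnd ⟩
    f B + f B             ∎
    where open ≤-Reasoning

  f[A∪⁅x⁆]≈f[A]+marg : ∀ A x → f (A ∪ ⁅ x ⁆) ≈ f A + marg f x A
  f[A∪⁅x⁆]≈f[A]+marg A x = ≈-sym (x+[y-x]≈y (f A) (f (A ∪ ⁅ x ⁆)))

  greedy-gainBound : ∀ {Q Q′ A x} → A ∪ ⁅ x ⁆ ⊆ B → x ∉ A → Q′ ⊆ Q → (∀ {z} → z ∈ Q′ → z ∉ A ∪ ⁅ x ⁆) →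
                     GreedyChoice Q A x → GainBound Q′ (A ∪ ⁅ x ⁆) (marg f x A)
  greedy-gainBound {Q} {Q′} {A} {x} A∪x⊆B x∉A Q′⊆Q Q′∩A∪x≡∅ (greedyChoice (_ , x-fits) maximal) =
    gainBound on-remaining on-candidates
    where
    open ≤-Reasoning
    on-remaining : ∀ {y} → y ∈ S → y ∈ Q′ → marg f y B ≤ marg f x A
    on-remaining {y} y∈S y∈Q′ = begin
      marg f y B  ≤⟨ f-submodular y (λ z∈A → A∪x⊆B (p⊆p∪q ⁅ x ⁆ z∈A)) (S∉B y∈S) ⟩
      marg f y A  ≤⟨ maximal y (Q′⊆Q y∈Q′ , y-fits) ⟩
      marg f x A  ∎
      where
      y-fits : ∣ A ∪ ⁅ y ⁆ ∣ ℕ.≤ k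
      y-fits = ℕₚ.≤-trans (∣p∪⁅x⁆∣≤1+∣p∣ A y) (subst (ℕ._≤ k) (x∉p⇒∣p∪⁅x⁆∣≡1+∣p∣ x∉A) x-fits)
    on-candidates : ∀ z → Feasible Q′ (A ∪ ⁅ x ⁆) z → marg f z (A ∪ ⁅ x ⁆) ≤ marg f x A
    on-candidates z (z∈Q′ , z-fits) = begin
      marg f z (A ∪ ⁅ x ⁆)  ≤⟨ f-submodular z (p⊆p∪q ⁅ x ⁆) (Q′∩A∪x≡∅ z∈Q′) ⟩
      marg f z A            ≤⟨ maximal z (Q′⊆Q z∈Q′ , z-fits′) ⟩
      marg f x A            ∎
      where
      z-fits′ : ∣ A ∪ ⁅ z ⁆ ∣ ℕ.≤ k
      z-fits′ = ℕₚ.≤-trans (p⊆q⇒∣p∣≤∣q∣ (p⊆q⇒p∪r⊆q∪r ⁅ z ⁆ (p⊆p∪q {p = A} ⁅ x ⁆))) z-fits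

  -- A new greedy pick has marginal value at most the previous gain, so it may replace it.
  greedy-bound : ∀ {A Y x} e {w} → (0 < e → marg f x A ≤ w) →
                 f (B ∪ Y) + e ×ₙ w ≤ f B + f A →
                 f (B ∪ Y) + suc e ×ₙ marg f x A ≤ f B + f (A ∪ ⁅ x ⁆)
  greedy-bound {A} {Y} {x} e {w} w′≤w bnd = begin
    f (B ∪ Y) + (w′ + e ×ₙ w′)  ≤⟨ +-monoʳ-≤ (f (B ∪ Y)) (+-monoʳ-≤ w′ (scaled e w′≤w)) ⟩
    f (B ∪ Y) + (w′ + e ×ₙ w)   ≈⟨ x∙yz≈y∙xz (f (B ∪ Y)) w′ (e ×ₙ w) ⟩
    w′ + (f (B ∪ Y) + e ×ₙ w)   ≤⟨ +-monoʳ-≤ w′ bnd ⟩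
    w′ + (f B + f A)            ≈⟨ x∙yz≈y∙xz w′ (f B) (f A) ⟩
    f B + (w′ + f A)            ≈⟨ +-congˡ (+-comm w′ (f A)) ⟩
    f B + (f A + w′)            ≈⟨ +-congˡ (f[A∪⁅x⁆]≈f[A]+marg A x) ⟨
    f B + f (A ∪ ⁅ x ⁆)         ∎
    where
    open ≤-Reasoning
    w′ : Carrier
    w′ = marg f x A
    scaled : ∀ e → (0 < e → w′ ≤ w) → e ×ₙ w′ ≤ e ×ₙ w
    scaled zero    _     = ≤-refl ≈-refl
    scaled (suc e) w′≤w = ×ₙ-monoʳ-≤ (suc e) (w′≤w (s≤s z≤n))

  potential-greedy-step : ∀ {Q Q′ A Y x} → A ∪ ⁅ x ⁆ ⊆ B → x ∉ A → Q′ ⊆ Q → (∀ {z} → z ∈ Q′ → z ∉ A ∪ ⁅ x ⁆) →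
                          GreedyChoice Q A x → Potential Q A Y → Potential Q′ (A ∪ ⁅ x ⁆) Y
  potential-greedy-step {A = A} {Y} {x} A∪x⊆B x∉A Q′⊆Q Q′∩A∪x≡∅ choice (potential e w bal _ bnd gb) =
    potential (suc e) (marg f x A) bal′ (x≤y⇒0≤y-x (f-mono (p⊆p∪q ⁅ x ⁆)))
      (greedy-bound e (λ e>0 → GainBound.on-candidates (gb e>0) x (GreedyChoice.feasible choice)) bnd)
      (λ _ → greedy-gainBound A∪x⊆B x∉A Q′⊆Q Q′∩A∪x≡∅ choice)
    where
    bal′ : suc e ℕ.+ ∣ Y ∣ ≡ ∣ A ∪ ⁅ x ⁆ ∣
    bal′ = trans (cong suc bal) (sym (x∉p⇒∣p∪⁅x⁆∣≡1+∣p∣ x∉A))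

  potential-opponent-step : ∀ {Q Q′ A Y y} → Q′ ⊆ Q → y ∈ S → y ∈ Q → y ∉ Y → ∣ Y ∣ < ∣ A ∣ →
                            Potential Q A Y → Potential Q′ A (Y ∪ ⁅ y ⁆)
  potential-opponent-step _ _ _ _ ∣Y∣<∣A∣ (potential zero _ bal _ _ _) = contradiction bal (ℕₚ.<⇒≢ ∣Y∣<∣A∣)
  potential-opponent-step {A = A} {Y} {y} Q′⊆Q y∈S y∈Q y∉Y _ (potential (suc e) w bal w≥0 bnd gb) =
    potential e w bal′ w≥0 bnd′ (λ _ → gainBound-shrink Q′⊆Q gain-bound)
    where
    open ≤-Reasoning
    gain-bound : GainBound _ A w
    gain-bound = gb (s≤s z≤n)
    bal′ : e ℕ.+ ∣ Y ∪ ⁅ y ⁆ ∣ ≡ ∣ A ∣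
    bal′ = trans (cong (e ℕ.+_) (x∉p⇒∣p∪⁅x⁆∣≡1+∣p∣ y∉Y)) (trans (ℕₚ.+-suc e ∣ Y ∣) bal)
    y∉B∪Y : y ∉ B ∪ Y
    y∉B∪Y y∈B∪Y with x∈p∪q⁻ B Y y∈B∪Y
    ... | inj₁ y∈B = S∉B y∈S y∈B
    ... | inj₂ y∈Y = y∉Y y∈Y
    bnd′ : f (B ∪ (Y ∪ ⁅ y ⁆)) + e ×ₙ w ≤ f B + f A
    bnd′ = begin
      f (B ∪ (Y ∪ ⁅ y ⁆)) + e ×ₙ w           ≡⟨ cong (λ Z → f Z + e ×ₙ w) (∪-assoc B Y ⁅ y ⁆) ⟨
      f ((B ∪ Y) ∪ ⁅ y ⁆) + e ×ₙ w           ≈⟨ +-congʳ (f[A∪⁅x⁆]≈f[A]+marg (B ∪ Y) y) ⟩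
      f (B ∪ Y) + marg f y (B ∪ Y) + e ×ₙ w  ≤⟨ +-mono-≤ (e ×ₙ w) (+-monoʳ-≤ (f (B ∪ Y)) (begin
        marg f y (B ∪ Y)                       ≤⟨ f-submodular y (p⊆p∪q Y) y∉B∪Y ⟩
        marg f y B                             ≤⟨ GainBound.on-remaining gain-bound y∈S y∈Q ⟩
        w                                      ∎)) ⟩
      f (B ∪ Y) + w + e ×ₙ w                 ≈⟨ +-assoc (f (B ∪ Y)) w (e ×ₙ w) ⟩
      f (B ∪ Y) + (w + e ×ₙ w)               ≤⟨ bnd ⟩
      f B + f A                              ∎

module GreedyAgainstOpponent
  {c ℓ₁ ℓ₂} (R : OrderedCommRing c ℓ₁ ℓ₂) (m n : ℕ) .{{_ : NonZero n}} (k : ℕ) (i j : Fin n)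
  (f : Subset m → OrderedCommRing.Carrier R) (p : Play m)
  (f-nonneg : SetFunctions.Nonnegative R f) (f-mono : SetFunctions.Monotone R f)
  (f-submodular : SetFunctions.Submodular R f)
  (legal : LegalPlay p) (greedy : Greedy.FollowsGreedy R p i f (cardinality k)) (i≢j : i ≢ j)
  (S : Subset m) (S⊆Sⱼ : S ⊆ selectedBy p j (turns m n)) (∣S∣≤k : ∣ S ∣ ℕ.≤ k)
  (first∉S : ¬ (toℕ i < toℕ j) → ∀ g → firstPickBy p j (turns m n) ≡ just g → g ∉ S)
  where

  open import Data.Nat using (zero; suc; _+_; _≤_; s≤s; z≤n; _≟_; _≤?_)
  open import Data.Nat.DivMod using (_%_)
  open import Data.Fin.Properties using (toℕ-injective; toℕ<n; any?)
  open import Data.Fin.Subset.Properties using (_∈?_; p∩q⊆p; q⊆p∪q; x∈p∩q⁺; ∩-zeroʳ; p⊆q⇒∣p∣≤∣q∣; p⊂q⇒∣p∣<∣q∣)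
  open import Data.Product using (∃; proj₁; proj₂)
  open import Relation.Nullary using (Dec)
  open import Relation.Nullary.Decidable using (_×-dec_)
  open import Relation.Binary.PropositionalEquality using (subst₂)
  open Protocol p

  T : ℕ
  T = turns m n

  A Y : ℕ → Subset m
  A t = selectedBy p i t
  Y t = S ∩ selectedBy p j t

  B : Subset m
  B = A T

  toℕi≢toℕj : toℕ i ≢ toℕ j
  toℕi≢toℕj = λ eq → i≢j (toℕ-injective eq)

  S∉B : ∀ {y} → y ∈ S → y ∉ B
  S∉B y∈S = selectedBy-disjoint legal (≢-sym i≢j) T ℕₚ.≤-refl (S⊆Sⱼ y∈S)

  open ExchangePotential R k f f-nonneg f-mono f-submodular B S S∉B

  greedy-picks : ∀ {t y} → t < T → t % n ≡ toℕ i → Feasible (available p t) (A t) y →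
                 ∃ λ x → p t ≡ just x × Feasible (available p t) (A t) x
  greedy-picks t<T own feasible with proj₁ (greedy _ t<T own) (_ , feasible)
  ... | x , pt , x-feasible , _ = x , pt , x-feasible

  greedy-choice : ∀ {t x} → t < T → t % n ≡ toℕ i → p t ≡ just x → GreedyChoice (available p t) (A t) x
  greedy-choice {t} t<T own pt with any? (λ z → (z ∈? available p t) ×-dec (∣ A t ∪ ⁅ z ⁆ ∣ ≤? k))
  ... | no none = contradiction (trans (sym pt) (proj₂ (greedy t t<T own) none)) λ ()
  ... | yes some with proj₁ (greedy t t<T own) some
  ...   | _ , pt′ , feasible , maximal with trans (sym pt) pt′
  ...     | refl = greedyChoice feasible maximal

  -- While an item it could take remains available, the greedy agent picks at each of its turns.
  greedy-keeps-pace : ∀ t → t ≤ T → ∀ {y} → y ∈ available p t → k ≤ ∣ A t ∣ ⊎ turnsAt n (toℕ i) t ≤ ∣ A t ∣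
  greedy-keeps-pace zero    _   _   = inj₂ z≤n
  greedy-keeps-pace (suc t) t<T y∈Q with k ≤? ∣ A t ∣
  ... | yes full = inj₁ (ℕₚ.≤-trans full (p⊆q⇒∣p∣≤∣q∣ (selectedBy-step i t)))
  ... | no ¬full with greedy-keeps-pace t (ℕₚ.<⇒≤ t<T) (available-step t y∈Q)
  ...   | inj₁ full = contradiction full ¬full
  ...   | inj₂ pace with t % n ≟ toℕ i
  ...     | no _    = inj₂ pace
  ...     | yes own
    with greedy-picks t<T own (available-step t y∈Q , ℕₚ.≤-trans (∣p∪⁅x⁆∣≤1+∣p∣ (A t) _) (ℕₚ.≰⇒> ¬full))
  ...       | x , pt , x∈Q , _ rewrite pt =
    inj₂ (subst (suc (turnsAt n (toℕ i) t) ≤_)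
                (sym (x∉p⇒∣p∪⁅x⁆∣≡1+∣p∣ (available⇒∉selectedBy i t x∈Q))) (s≤s pace))

  -- When i moves after j in each round, j's first pick is not in S and makes up for the missing turn.
  ∣Y∣<∣Sⱼ∣ : ∀ {t y} → ¬ (toℕ i < toℕ j) → t < T → t % n ≡ toℕ j → p t ≡ just y → y ∈ S →
             ∣ Y t ∣ < ∣ selectedBy p j t ∣
  ∣Y∣<∣Sⱼ∣ {t} {y} i≮j t<T own pt y∈S with firstPickBy p j t in first
  ... | just g  = p⊂q⇒∣p∣<∣q∣ (p∩q⊆q S _ , g , firstPickBy∈selectedBy j t first , g∉Y)
    where
    g∉Y : g ∉ Y t
    g∉Y g∈Y = first∉S i≮j g (firstPickBy-stable j (ℕₚ.<⇒≤ t<T) first) (p∩q⊆p S _ g∈Y)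
  ... | nothing =
    contradiction y∈S (first∉S i≮j y (firstPickBy-stable j t<T (trans (firstPickBy-own j t first own) pt)))

  Y-lags-selectedBy : ∀ {t y} → t < T → t % n ≡ toℕ j → p t ≡ just y → y ∈ S →
                      suc ∣ Y t ∣ ≤ ∣ selectedBy p j t ∣ + window (toℕ i) (toℕ j) (toℕ j)
  Y-lags-selectedBy {t} t<T own pt y∈S = lags (toℕ i ℕ.<? toℕ j)
    where
    lags : Dec (toℕ i < toℕ j) → suc ∣ Y t ∣ ≤ ∣ selectedBy p j t ∣ + window (toℕ i) (toℕ j) (toℕ j)
    lags (yes i<j) rewrite window-1 i<j (ℕₚ.≤-refl {toℕ j}) | ℕₚ.+-comm ∣ selectedBy p j t ∣ 1 =
      s≤s (p⊆q⇒∣p∣≤∣q∣ (p∩q⊆q S _))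
    lags (no i≮j) rewrite window-≤ (toℕ i) (toℕ j) (ℕₚ.≮⇒≥ i≮j) | ℕₚ.+-identityʳ ∣ selectedBy p j t ∣ =
      ∣Y∣<∣Sⱼ∣ i≮j t<T own pt y∈S

  opponent-lags : ∀ {t y} → t < T → t % n ≡ toℕ j → p t ≡ just y → y ∈ S → ∣ Y t ∣ < ∣ A t ∣
  opponent-lags {t} {y} t<T own pt y∈S with greedy-keeps-pace t (ℕₚ.<⇒≤ t<T) (legal t y t<T pt)
  ... | inj₁ full = ℕₚ.<-≤-trans (p⊂q⇒∣p∣<∣q∣ (p∩q⊆p S _ , y , y∈S , y∉Y)) (ℕₚ.≤-trans ∣S∣≤k full)
    where
    y∉Y : y ∉ Y t
    y∉Y y∈Y = available⇒∉selectedBy j t (legal t y t<T pt) (p∩q⊆q S _ y∈Y)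
  ... | inj₂ pace = begin
    suc ∣ Y t ∣                                           ≤⟨ Y-lags-selectedBy t<T own pt y∈S ⟩
    ∣ selectedBy p j t ∣ + window (toℕ i) (toℕ j) (toℕ j)  ≤⟨ ℕₚ.+-monoˡ-≤ _ (∣selectedBy∣≤turnsAt j t) ⟩
    turnsAt n (toℕ j) t + window (toℕ i) (toℕ j) (toℕ j)  ≡⟨ turnsAt-at-own-turn n (toℕ<n i) (toℕ<n j) toℕi≢toℕj t own ⟩
    turnsAt n (toℕ i) t                                   ≤⟨ pace ⟩
    ∣ A t ∣                                               ∎
    where open ℕₚ.≤-Reasoning

  Invariant : ℕ → Set (c ⊔ ℓ₂)
  Invariant t = Potential (available p t) (A t) (Y t)

  idle-move : ∀ {t} → A (suc t) ≡ A t → Y (suc t) ≡ Y t → Invariant t → Invariant (suc t)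
  idle-move {t} A′≡A Y′≡Y P =
    subst₂ (Potential (available p (suc t))) (sym A′≡A) (sym Y′≡Y) (potential-shrink (available-step t) P)

  greedy-move : ∀ {t x} → t < T → t % n ≡ toℕ i → p t ≡ just x → Invariant t → Invariant (suc t)
  greedy-move {t} {x} t<T own pt P =
    subst₂ (Potential (available p (suc t))) (sym A′≡A∪x) (sym Y′≡Y)
      (potential-greedy-step A∪x⊆B x∉A (available-step t) available∉A∪x choice P)
    where
    choice : GreedyChoice (available p t) (A t) x
    choice = greedy-choice t<T own pt
    A′≡A∪x : A (suc t) ≡ A t ∪ ⁅ x ⁆
    A′≡A∪x = selectedBy-pick own pt
    Y′≡Y : Y (suc t) ≡ Y t
    Y′≡Y = cong (S ∩_) (selectedBy-other (λ own′ → toℕi≢toℕj (trans (sym own) own′)))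
    x∉A : x ∉ A t
    x∉A = available⇒∉selectedBy i t (proj₁ (GreedyChoice.feasible choice))
    A∪x⊆B : A t ∪ ⁅ x ⁆ ⊆ B
    A∪x⊆B = subst (_⊆ B) A′≡A∪x (selectedBy-mono i t<T)
    available∉A∪x : ∀ {z} → z ∈ available p (suc t) → z ∉ A t ∪ ⁅ x ⁆
    available∉A∪x {z} z∈Q = subst (z ∉_) A′≡A∪x (available⇒∉selectedBy i (suc t) z∈Q)

  opponent-move : ∀ {t y} → t < T → t % n ≢ toℕ i → t % n ≡ toℕ j → p t ≡ just y → y ∈ S →
                  Invariant t → Invariant (suc t)
  opponent-move {t} {y} t<T ¬own own pt y∈S P =
    subst₂ (Potential (available p (suc t))) (sym (selectedBy-other ¬own)) (sym Y′≡Y∪y)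
      (potential-opponent-step (available-step t) y∈S y∈Q y∉Y (opponent-lags t<T own pt y∈S) P)
    where
    y∈Q : y ∈ available p t
    y∈Q = legal t y t<T pt
    y∉Y : y ∉ Y t
    y∉Y y∈Y = available⇒∉selectedBy j t y∈Q (p∩q⊆q S _ y∈Y)
    Y′≡Y∪y : Y (suc t) ≡ Y t ∪ ⁅ y ⁆
    Y′≡Y∪y = trans (cong (S ∩_) (selectedBy-pick own pt)) (x∈p⇒p∩[q∪⁅x⁆]≡p∩q∪⁅x⁆ _ y∈S)

  invariant-step : ∀ {t} → t < T → Dec (t % n ≡ toℕ i) → Dec (t % n ≡ toℕ j) → ∀ mx → p t ≡ mx →
                   Invariant t → Invariant (suc t)
  invariant-step t<T (yes ownᵢ) _ (just x) pt = greedy-move t<T ownᵢ pt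
  invariant-step t<T (yes ownᵢ) _ nothing  pt =
    idle-move (selectedBy-pass ownᵢ pt)
              (cong (S ∩_) (selectedBy-other (λ ownⱼ → toℕi≢toℕj (trans (sym ownᵢ) ownⱼ))))
  invariant-step t<T (no ¬ownᵢ) (yes ownⱼ) nothing pt =
    idle-move (selectedBy-other ¬ownᵢ) (cong (S ∩_) (selectedBy-pass ownⱼ pt))
  invariant-step t<T (no ¬ownᵢ) (yes ownⱼ) (just y) pt with y ∈? S
  ... | yes y∈S = opponent-move t<T ¬ownᵢ ownⱼ pt y∈S
  ... | no  y∉S =
    idle-move (selectedBy-other ¬ownᵢ)
              (trans (cong (S ∩_) (selectedBy-pick ownⱼ pt)) (x∉p⇒p∩[q∪⁅x⁆]≡p∩q _ y∉S))
  invariant-step t<T (no ¬ownᵢ) (no ¬ownⱼ) _ _ =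
    idle-move (selectedBy-other ¬ownᵢ) (cong (S ∩_) (selectedBy-other ¬ownⱼ))

  invariant : ∀ t → t ≤ T → Invariant t
  invariant zero    _   = subst (Potential (available p 0) ⊥) (sym (∩-zeroʳ S)) potential-empty
  invariant (suc t) t<T =
    invariant-step t<T (t % n ≟ toℕ i) (t % n ≟ toℕ j) (p t) refl (invariant t (ℕₚ.<⇒≤ t<T))

  open OrderedCommRing R using () renaming (_≤_ to infix 4 _≤ᴿ_; _+_ to infixl 6 _+ᴿ_; ≤-trans to ≤ᴿ-trans)

  value-bound : f S ≤ᴿ f B +ᴿ f B
  value-bound = ≤ᴿ-trans (f-mono S⊆B∪Y) (potential-final (invariant T ℕₚ.≤-refl))
    where
    S⊆B∪Y : S ⊆ B ∪ Y T
    S⊆B∪Y y∈S = q⊆p∪q B (Y T) (x∈p∩q⁺ (y∈S , S⊆Sⱼ y∈S))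

theorem5 : ∀ {c ℓ₁ ℓ₂} (R : OrderedCommRing c ℓ₁ ℓ₂) →
    let open OrderedCommRing R in
    let open SetFunctions R in
    let open Greedy R in
    ∀ (m n : ℕ) .{{_ : NonZero n}} (k : ℕ) (i j : Fin n) (f : Subset m → Carrier) (p : Play m) →
    Normalized f → Nonnegative f → Monotone f → Submodular f →
    LegalPlay p →
    FollowsGreedy p i f (cardinality k) →
    ¬ (i ≡ j) →
    let T = turns m n in
    let Si = selectedBy p i T in
    let Sj = selectedBy p j T in
    let g = firstPickBy p j T in
    ∀ (Sj′ : Subset m) →
    (toℕ i < toℕ j → Sj′ ≡ Sj) →
    (¬ (toℕ i < toℕ j) → Sj′ ≡ removePick Sj g) →
    ∀ S → restrict (cardinality k) Sj′ S → f S ≤ (f Si + f Si)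
theorem5 R m n k i j f p _ f-nonneg f-mono f-submodular legal greedy i≢j Sj′ Sj′-if-i<j Sj′-if-i≮j S
         (X , ∣X∣≤k , S≡X∩Sj′) =
  GreedyAgainstOpponent.value-bound R m n k i j f p f-nonneg f-mono f-submodular legal greedy i≢j
    S (λ y∈S → Sj′⊆Sj (S⊆Sj′ y∈S)) ∣S∣≤k first∉S
  where
  Sj : Subset m
  Sj = selectedBy p j (turns m n)
  first : Maybe (Fin m)
  first = firstPickBy p j (turns m n)

  S⊆Sj′ : S ⊆ Sj′
  S⊆Sj′ y∈S = p∩q⊆q X Sj′ (subst (_ ∈_) S≡X∩Sj′ y∈S)

  Sj′⊆Sj : Sj′ ⊆ Sj
  Sj′⊆Sj with toℕ i ℕ.<? toℕ j
  ... | yes i<j = subst (_⊆ Sj) (sym (Sj′-if-i<j i<j)) ⊆-refl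
  ... | no  i≮j = subst (_⊆ Sj) (sym (Sj′-if-i≮j i≮j)) (removePick-⊆ Sj first)

  ∣S∣≤k : ∣ S ∣ ℕ.≤ k
  ∣S∣≤k = subst (λ Z → ∣ Z ∣ ℕ.≤ k) (sym S≡X∩Sj′) (ℕₚ.≤-trans (∣p∩q∣≤∣p∣ X Sj′) ∣X∣≤k)

  first∉S : ¬ (toℕ i < toℕ j) → ∀ g → first ≡ just g → g ∉ S
  first∉S i≮j g first≡g g∈S =
    x∈p─q⇒x∉q (subst (g ∈_) (trans (Sj′-if-i≮j i≮j) (cong (removePick Sj) first≡g)) (S⊆Sj′ g∈S)) (x∈⁅x⁆ g)
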